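{- Let $\sigma,\tau\in\mathfrak{S}_n^{\nearrow}$. If $\mathrm{AX}(\sigma)=\mathrm{AX}(\tau)$ and $\sigma(i)=\tau(i)$ for every $i\in\mathrm{AX}(\sigma)$, then $\sigma=\tau$. (That is, a permutation with non-decreasing nom code is entirely determined by its set of anti-exceedances and their values.)
   Context: $[n]=\{1,\dots,n\}$, $\mathfrak{S}_n$ the symmetric group on $[n]$; products of permutations are composed with the leftmost factor acting first: $(\alpha\beta)(x)=\beta(\alpha(x))$. A function $f:[n]\to[n]$ is subexceedant if $1\le f(i)\le i$ for all $i$, written as $f_1\cdots f_n$; $F_n$ is the set of such functions. $\phi:F_n\to\mathfrak{S}_n$, $\phi(f)=(1,f_1)(2,f_2)\cdots(n,f_n)$ (with $(i,i)$ the identity), is a bijection. $F_n^{\nearrow}$ is the set of non-decreasing ($f_1\le\cdots\le f_n$) subexceedant functions on $[n]$, and $\mathfrak{S}_n^{\nearrow}=\phi(F_n^{\nearrow})$. $\mathrm{AX}(\sigma)=\{i\in[n]:\sigma(i)\le i\}$. -}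

module Defs where

open import Data.Nat using (ℕ; _≤_)
open import Data.Fin using (Fin; toℕ; _≟_)
open import Data.List using (List; foldl)
open import Data.Vec.Functional using (Vector)
open import Data.Fin.Base using ()
open import Data.List.Base using ()
open import Data.Bool using (if_then_else_)
open import Relation.Nullary.Decidable using (does)
open import Relation.Binary.PropositionalEquality using (_≡_)
open import Data.Product using (Σ; _×_)
open import Data.List using (allFin)

-- Positions 1..n of the paper are Fin n = {0,…,n-1}; i ↦ i+1.
-- The order ≤ on positions/values is compared via toℕ (shift-invariant).

transposition : ∀ {n} → Fin n → Fin n → Fin n → Fin n
transposition a b x =
  if does (x ≟ a) then b else (if does (x ≟ b) then a else x)

Subexceedant : ∀ {n} → (Fin n → Fin n) → Set
Subexceedant {n} f = ∀ (i : Fin n) → toℕ (f i) ≤ toℕ i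

NonDecreasing : ∀ {n} → (Fin n → Fin n) → Set
NonDecreasing {n} f = ∀ (i j : Fin n) → toℕ i ≤ toℕ j → toℕ (f i) ≤ toℕ (f j)

IsInFnUp : ∀ {n} → (Fin n → Fin n) → Set
IsInFnUp f = Subexceedant f × NonDecreasing f

-- φ(f) = (1,f1)(2,f2)…(n,fn), leftmost factor acting first:
-- φ(f)(x) = (n,fn)( … (2,f2)((1,f1)(x)) … )
φ : ∀ {n} → (Fin n → Fin n) → Fin n → Fin n
φ {n} f x = foldl (λ y i → transposition i (f i) y) x (allFin n)

InSnUp : ∀ {n} → (Fin n → Fin n) → Set
InSnUp {n} σ = Σ (Fin n → Fin n) (λ f → IsInFnUp f × (∀ x → σ x ≡ φ f x))

InAX : ∀ {n} → (Fin n → Fin n) → Fin n → Set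
InAX σ i = toℕ (σ i) ≤ toℕ i

{-# OPTIONS --safe #-}
-- Follow a point x through the product (1,f₁)(2,f₂)⋯(n,fₙ) for a subexceedant f.
-- It stays at x until the factor (x,fₓ) sends it to fₓ ≤ x; afterwards a factor
-- (i,fᵢ) with i > x moves the current value only when that value is fᵢ, and then
-- sends it up to i.  Hence x is an anti-exceedance of φ(f) with φ(f)(x) = fₓ when
-- the value fₓ is not taken again by f after x, and φ(f)(x) > x otherwise.
-- For non-decreasing codes f and g this lets us recover f = g downwards from n:
-- at an anti-exceedance the value is given, and at any other x both codes take
-- their value at x again later, so by monotonicity fₓ = fⱼ = gⱼ = gₓ for some j > x.
module Submission where

open import Defs
open import Data.Nat as ℕ using (ℕ; zero; suc)
import Data.Nat.Properties as ℕ
open import Data.Fin using (Fin; toℕ; _≟_; _<_; _≤_)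
open import Data.Fin.Properties using (toℕ<n; <-cmp; <⇒≢; ≤-antisym; ≤-total)
open import Data.Fin.Induction using (>-wellFounded)
open import Data.List using (foldl; tabulate; allFin)
open import Data.List.Properties using (foldl-cong; foldl-map; map-tabulate)
open import Data.Product using (∃; _×_; _,_; proj₁; proj₂)
open import Data.Sum using (_⊎_; inj₁; inj₂)
open import Function using (id; _∘_)
open import Induction.WellFounded using (module All)
open import Relation.Binary using (tri<; tri≈; tri>)
open import Relation.Binary.PropositionalEquality
open import Relation.Nullary using (¬_; Dec; yes; no; contradiction)
open import Relation.Nullary.Decidable using (dec-true; dec-false)

transposition-left : ∀ {n} (a b : Fin n) → transposition a b a ≡ b
transposition-left a b rewrite dec-true (a ≟ a) refl = refl

transposition-right : ∀ {n} (a b : Fin n) → transposition a b b ≡ a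
transposition-right a b with b ≟ a
... | yes b≡a = b≡a
... | no _ rewrite dec-true (b ≟ b) refl = refl

transposition-fixes : ∀ {n} (a b y : Fin n) → y ≢ a → y ≢ b → transposition a b y ≡ y
transposition-fixes a b y y≢a y≢b rewrite dec-false (y ≟ a) y≢a | dec-false (y ≟ b) y≢b = refl

foldl-allFin-invariant : ∀ {a p} {A : Set a} (P : ℕ → A → Set p) {n} (step : A → Fin n → A) →
  (∀ i {y} → P (toℕ i) y → P (suc (toℕ i)) (step y i)) →
  ∀ {x} → P 0 x → P n (foldl step x (allFin n))
foldl-allFin-invariant P {zero} step preserve Px = Px
foldl-allFin-invariant P {suc n} step preserve {x} Px =
  subst (P (suc n)) shifted
    (foldl-allFin-invariant (P ∘ suc) (λ y i → step y (Fin.suc i)) (preserve ∘ Fin.suc) (preserve Fin.zero Px))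
  where
  shifted : ∀ {z} → foldl (λ y i → step y (Fin.suc i)) z (allFin n) ≡ foldl step z (tabulate Fin.suc)
  shifted {z} = trans (sym (foldl-map step Fin.suc z (allFin n))) (cong (foldl step z) (map-tabulate id Fin.suc))

φ-cong : ∀ {n} {f g : Fin n → Fin n} → (∀ i → f i ≡ g i) → ∀ x → φ f x ≡ φ g x
φ-cong {n} f≗g x = foldl-cong (λ y i → cong (λ b → transposition i b y) (f≗g i)) x (allFin n)

Repeated : ∀ {n} → (Fin n → Fin n) → Fin n → Set
Repeated f x = ∃ λ i → x < i × f i ≡ f x

module _ {n} {f : Fin n → Fin n} (sub : Subexceedant f) (x : Fin n) where

  private
    Moved : ℕ → Fin n → Set
    Moved j y = y ≡ f x ⊎ (x < y × toℕ y ℕ.< j × Repeated f x)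

    -- Where x has been carried after the factors (1,f₁)⋯(j,fⱼ).
    Position : ℕ → Fin n → Set
    Position j y = (j ℕ.≤ toℕ x → y ≡ x) × (toℕ x ℕ.< j → Moved j y)

    ≢-below : ∀ {y z : Fin n} → y < z → z ≢ y
    ≢-below y<z = <⇒≢ y<z ∘ sym

    before : ∀ {i} → i < x → Position (suc (toℕ i)) (transposition i (f i) x)
    before {i} i<x =
        (λ _ → transposition-fixes i (f i) x (≢-below i<x) (≢-below (ℕ.≤-<-trans (sub i) i<x)))
      , (λ x<1+i → contradiction i<x (ℕ.≤⇒≯ (ℕ.≤-pred x<1+i)))

    at : Position (suc (toℕ x)) (transposition x (f x) x)
    at = (λ x<x → contradiction x<x (ℕ.n≮n _)) , (λ _ → inj₁ (transposition-left x (f x)))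

    sent-up : ∀ {i y} → x < i → y ≡ f i → Repeated f x → Moved (suc (toℕ i)) (transposition i (f i) y)
    sent-up {i} x<i refl rep rewrite transposition-right i (f i) = inj₂ (x<i , ℕ.n<1+n _ , rep)

    after : ∀ {i y} → x < i → Moved (toℕ i) y → Moved (suc (toℕ i)) (transposition i (f i) y)
    after {i} {y} x<i moved = decide (y ≟ f i) moved
      where
      decide : Dec (y ≡ f i) → Moved (toℕ i) y → Moved (suc (toℕ i)) (transposition i (f i) y)
      decide (yes y≡fi) (inj₁ y≡fx) = sent-up x<i y≡fi (i , x<i , trans (sym y≡fi) y≡fx)
      decide (yes y≡fi) (inj₂ (_ , _ , rep)) = sent-up x<i y≡fi rep
      decide (no y≢fi) (inj₁ refl)
        rewrite transposition-fixes i (f i) (f x) (<⇒≢ (ℕ.≤-<-trans (sub x) x<i)) y≢fi = inj₁ refl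
      decide (no y≢fi) (inj₂ (x<y , y<i , rep)) rewrite transposition-fixes i (f i) y (<⇒≢ y<i) y≢fi =
        inj₂ (x<y , ℕ.m<n⇒m<1+n y<i , rep)

    preserve : ∀ i {y} → Position (toℕ i) y → Position (suc (toℕ i)) (transposition i (f i) y)
    preserve i (early , late) with <-cmp i x
    ... | tri< i<x _ _ rewrite early (ℕ.<⇒≤ i<x) = before i<x
    ... | tri≈ _ refl _ rewrite early ℕ.≤-refl = at
    ... | tri> _ _ x<i = (λ 1+i≤x → contradiction (ℕ.<⇒≤ 1+i≤x) (ℕ.<⇒≱ x<i)) , (λ _ → after x<i (late x<i))

  φ-image : φ f x ≡ f x ⊎ (x < φ f x × Repeated f x)
  φ-image with proj₂ (foldl-allFin-invariant Position (λ y i → transposition i (f i) y) preserve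
                        ((λ _ → refl) , λ ())) (toℕ<n x)
  ... | inj₁ φx≡fx = inj₁ φx≡fx
  ... | inj₂ (x<φx , _ , rep) = inj₂ (x<φx , rep)

antiExceedance-dichotomy : ∀ {n} {σ f : Fin n → Fin n} → Subexceedant f → (∀ x → σ x ≡ φ f x) →
  ∀ x → (InAX σ x × σ x ≡ f x) ⊎ (¬ InAX σ x × Repeated f x)
antiExceedance-dichotomy sub σ≗φf x rewrite σ≗φf x with φ-image sub x
... | inj₁ φx≡fx = inj₁ (subst (_≤ x) (sym φx≡fx) (sub x) , φx≡fx)
... | inj₂ (x<φx , rep) = inj₂ (ℕ.<⇒≱ x<φx , rep)

nondecreasing-squeeze : ∀ {n} {f : Fin n → Fin n} → NonDecreasing f →
  ∀ {x j i} → x ≤ j → j ≤ i → f i ≡ f x → f j ≡ f x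
nondecreasing-squeeze {f = f} mono {x} {j} {i} x≤j j≤i fi≡fx =
  ≤-antisym (subst (f j ≤_) fi≡fx (mono j i j≤i)) (mono x j x≤j)

repeated-nondecreasing-agree : ∀ {n} {f g : Fin n → Fin n} → NonDecreasing f → NonDecreasing g →
  ∀ {x} → Repeated f x → Repeated g x → (∀ {i} → x < i → f i ≡ g i) → f x ≡ g x
repeated-nondecreasing-agree monof monog (i , x<i , fi≡fx) (i′ , x<i′ , gi′≡gx) agreeAbove
  with ≤-total i i′
... | inj₁ i≤i′ = trans (sym fi≡fx) (trans (agreeAbove x<i) (nondecreasing-squeeze monog (ℕ.<⇒≤ x<i) i≤i′ gi′≡gx))
... | inj₂ i′≤i = trans (sym (nondecreasing-squeeze monof (ℕ.<⇒≤ x<i′) i′≤i fi≡fx)) (trans (agreeAbove x<i′) gi′≡gx)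

proposition4p4 : (n : ℕ) (σ τ : Fin n → Fin n) →
    InSnUp σ → InSnUp τ →
    (∀ i → (InAX σ i → InAX τ i) × (InAX τ i → InAX σ i)) →
    (∀ i → InAX σ i → σ i ≡ τ i) →
    ∀ x → σ x ≡ τ x
proposition4p4 n σ τ (f , (subf , monof) , σ≗φf) (g , (subg , monog) , τ≗φg) sameAX sameValues x =
  begin
    σ x   ≡⟨ σ≗φf x ⟩
    φ f x ≡⟨ φ-cong f≗g x ⟩
    φ g x ≡⟨ τ≗φg x ⟨
    τ x   ∎
  where
  open ≡-Reasoning

  agree-below : ∀ y → (∀ {i} → y < i → f i ≡ g i) → f y ≡ g y
  agree-below y agreeAbove
    with antiExceedance-dichotomy subf σ≗φf y | antiExceedance-dichotomy subg τ≗φg y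
  ... | inj₁ (σy-ax , σy≡fy) | inj₁ (_ , τy≡gy) = trans (sym σy≡fy) (trans (sameValues y σy-ax) τy≡gy)
  ... | inj₁ (σy-ax , _) | inj₂ (τy-nax , _) = contradiction (proj₁ (sameAX y) σy-ax) τy-nax
  ... | inj₂ (σy-nax , _) | inj₁ (τy-ax , _) = contradiction (proj₂ (sameAX y) τy-ax) σy-nax
  ... | inj₂ (_ , f-rep) | inj₂ (_ , g-rep) = repeated-nondecreasing-agree monof monog f-rep g-rep agreeAbove

  f≗g : ∀ y → f y ≡ g y
  f≗g = All.wfRec >-wellFounded _ (λ y → f y ≡ g y) agree-below
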